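{- Let $\Lambda$ be a ring with identity and $A,B,C,D\in\Lambda$. Then $(1-G(w)Az)G_0^*=G(w^*)$ in $\Lambda[[z]]$.
   Context: A walk of length $l\ge0$ is an $(l+1)$-tuple $\alpha=(\alpha_0,\dots,\alpha_l)$ of integers with each $\alpha_i-\alpha_{i-1}\in\{ -1,0,1\}$; it is a walk from $\alpha_0$ to $\alpha_l$. Weights: $w(\alpha)=1$ if $l=0$, else $w(\alpha)=U_1\cdots U_l$ with $U_i=A,B,C$ according as $\alpha_i-\alpha_{i-1}=-1,0,1$; $w^*(\alpha)$ is defined the same way except that $U_i=D$ (instead of $B$) whenever $\alpha_{i-1}=\alpha_i=0$. A walk is standard if $\alpha_i\ge\alpha_l$ for all $i$. $G(w)=\sum w(\alpha)z^{l(\alpha)}$ and $G(w^*)=\sum w^*(\alpha)z^{l(\alpha)}$, sums over all standard walks from $0$ to $0$. For $r\ge0$, $G_r^*=\sum\binom{\alpha_0}{r}w^*(\alpha)z^{l(\alpha)}$, the sum over all standard walks finishing at $0$. -}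

module Defs where

open import Level using (_⊔_)
open import Algebra.Bundles using (Ring)
open import Data.Nat as ℕ using (ℕ; zero; suc)
open import Data.Nat.Combinatorics renaming (_C_ to binom) using ()
open import Data.Integer as ℤ using (ℤ; +_; -[1+_]; ∣_∣)
open import Data.List using (List; []; _∷_; map; concatMap; foldr; length)
open import Data.List.Relation.Unary.All using (All; all?)
open import Data.Bool using (Bool; true; false; if_then_else_; _∧_)
open import Relation.Nullary using (does)

data Step : Set where
  dn fl up : Step

δ : Step → ℤ
δ dn = ℤ.- (+ 1)
δ fl = + 0
δ up = + 1

record Walk : Set where
  constructor walk
  field
    start : ℤ
    steps : List Step
open Walk public

len : Walk → ℕ
len α = length (steps α)

positionsFrom : ℤ → List Step → List ℤ
positionsFrom a []       = a ∷ []
positionsFrom a (s ∷ ss) = a ∷ positionsFrom (a ℤ.+ δ s) ss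

positions : Walk → List ℤ
positions α = positionsFrom (start α) (steps α)

endFrom : ℤ → List Step → ℤ
endFrom a []       = a
endFrom a (s ∷ ss) = endFrom (a ℤ.+ δ s) ss

finish : Walk → ℤ
finish α = endFrom (start α) (steps α)

Standard : Walk → Set
Standard α = All (λ x → finish α ℤ.≤ x) (positions α)

standard? : Walk → Bool
standard? α = does (all? (λ x → finish α ℤ.≤? x) (positions α))

stepSeqs : ℕ → List (List Step)
stepSeqs zero    = [] ∷ []
stepSeqs (suc n) = concatMap (λ ss → (dn ∷ ss) ∷ (fl ∷ ss) ∷ (up ∷ ss) ∷ []) (stepSeqs n)

sumδ : List Step → ℤ
sumδ []       = + 0
sumδ (s ∷ ss) = δ s ℤ.+ sumδ ss

walksFrom0 : ℕ → List Walk
walksFrom0 n = map (walk (+ 0)) (stepSeqs n)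

-- all walks of length n finishing at 0 (the start is determined by the steps)
walksTo0 : ℕ → List Walk
walksTo0 n = map (λ ss → walk (ℤ.- sumδ ss) ss) (stepSeqs n)

isZero : ℤ → Bool
isZero a = does (a ℤ.≟ + 0)

module PowerSeries {c ℓ} (R : Ring c ℓ) where
  open Ring R

  PS : Set c
  PS = ℕ → Carrier

  _≈PS_ : PS → PS → Set ℓ
  f ≈PS g = ∀ n → f n ≈ g n

  Σl : List Carrier → Carrier
  Σl = foldr _+_ 0#

  nat : ℕ → Carrier
  nat zero    = 0#
  nat (suc n) = 1# + nat n

  onePS : PS
  onePS zero    = 1#
  onePS (suc _) = 0#

  zPS : PS
  zPS 1 = 1#
  zPS _ = 0#

  const : Carrier → PS
  const a zero    = a
  const a (suc _) = 0#

  _+PS_ : PS → PS → PS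
  (f +PS g) n = f n + g n

  -PS_ : PS → PS
  (-PS f) n = - (f n)

  _-PS_ : PS → PS → PS
  f -PS g = f +PS (-PS g)

  -- Cauchy product: (f g)_n = Σ_{i+j=n} f_i g_j
  convAux : PS → PS → ℕ → ℕ → Carrier
  convAux f g zero    m = f 0 * g m
  convAux f g (suc i) m = f (suc i) * g m + convAux f g i (suc m)

  _*PS_ : PS → PS → PS
  (f *PS g) n = convAux f g n 0

  module Weights (A B C D : Carrier) where

    U : Step → Carrier
    U dn = A
    U fl = B
    U up = C

    wSteps : List Step → Carrier
    wSteps []       = 1#
    wSteps (s ∷ ss) = U s * wSteps ss

    w : Walk → Carrier
    w α = wSteps (steps α)

    U* : ℤ → Step → Carrier
    U* a fl = if isZero a then D else B
    U* a s  = U s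

    w*From : ℤ → List Step → Carrier
    w*From a []       = 1#
    w*From a (s ∷ ss) = U* a s * w*From (a ℤ.+ δ s) ss

    w* : Walk → Carrier
    w* α = w*From (start α) (steps α)

    Gw : PS
    Gw n = Σl (map (λ α → if standard? α ∧ isZero (finish α) then w α else 0#) (walksFrom0 n))

    Gw* : PS
    Gw* n = Σl (map (λ α → if standard? α ∧ isZero (finish α) then w* α else 0#) (walksFrom0 n))

    -- G*_r = Σ binom(α_0, r) w*(α) z^l over standard walks finishing at 0
    -- (α_0 ≥ 0 for such walks, so binom(α_0,r) = binom(∣α_0∣,r))
    G* : ℕ → PS
    G* r n = Σl (map (λ α → if standard? α then nat (binom ∣ start α ∣ r) * w* α else 0#) (walksTo0 n))

-- Write P h for the generating function of standard walks from height h to 0 (weight w*), so that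
-- G(w*) = P 0 and G*_0 = Σ_h P h, and Q h for the same with D replaced by B, so that G(w) = Q 0.
-- Cutting a walk from h + 1 + k at its first visit to height k gives P (h + 1 + k) = z (Q h) A (P k):
-- before that visit it stays above k, hence never sees a flat step at 0.  Summing over all starting
-- heights except 0 yields G*_0 = G(w*) + G(w) A z G*_0.
module Submission where

open import Defs
open import Algebra.Bundles using (Ring)
import Algebra.Properties.AbelianGroup as AbelianGroupProperties
import Algebra.Properties.CommutativeSemigroup as CommutativeSemigroupProperties
import Algebra.Properties.Ring as RingProperties
open import Data.Bool using (Bool; true; false; if_then_else_; _∧_)
open import Data.Bool.Properties using (∧-assoc; ∧-zeroʳ; if-eta; if-cong; if-cong-then)
open import Data.Integer as ℤ using (ℤ; +_; -[1+_])
import Data.Integer.Properties as ℤ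
open import Data.List using (List; []; _∷_; map; concatMap; length; _++_)
open import Data.List.Properties using (map-∘; map-++)
open import Function using (_∘_)
open import Data.Nat as ℕ using (ℕ; zero; suc; _≤_; _<_; z≤n; s≤s)
import Data.Nat.Properties as ℕ
open import Relation.Binary.PropositionalEquality as ≡ using (_≡_; _≢_)
open import Relation.Nullary using (Dec; does; yes; no)
open import Relation.Nullary.Decidable using (dec-true; dec-false)

open AbelianGroupProperties ℤ.+-0-abelianGroup using (inverseˡ-unique)

standardTo0? : ℤ → List Step → Bool
standardTo0? a ss = standard? (walk a ss) ∧ isZero (finish (walk a ss))

isZero⇒≡0 : ∀ a → isZero a ≡ true → a ≡ + 0
isZero⇒≡0 a = go (a ℤ.≟ + 0)
  where
  go : (a≟0 : Dec (a ≡ + 0)) → does a≟0 ≡ true → a ≡ + 0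
  go (yes a≡0) _ = a≡0
  go (no _)    ()

guarded-∧-assoc : ∀ b b′ x z → (z ≡ true → b ≡ b′) → (b ∧ x) ∧ z ≡ b′ ∧ (x ∧ z)
guarded-∧-assoc b b′ x true  b≡b′ rewrite b≡b′ ≡.refl = ∧-assoc b′ x true
guarded-∧-assoc b b′ x false _ rewrite ∧-zeroʳ (b ∧ x) | ∧-zeroʳ x | ∧-zeroʳ b′ = ≡.refl

-- For a walk ending at 0, standardness means staying ≥ 0, which can be checked one step at a time.
standardTo0?-∷ : ∀ a s ss →
  standardTo0? a (s ∷ ss) ≡ does (+ 0 ℤ.≤? a) ∧ standardTo0? (a ℤ.+ δ s) ss
standardTo0?-∷ a s ss =
  guarded-∧-assoc _ _ _ (isZero f) (λ f≡0 → ≡.cong (λ b → does (b ℤ.≤? a)) (isZero⇒≡0 f f≡0))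
  where f = endFrom (a ℤ.+ δ s) ss

endFrom≡start+sumδ : ∀ a ss → endFrom a ss ≡ a ℤ.+ sumδ ss
endFrom≡start+sumδ a []       = ≡.sym (ℤ.+-identityʳ a)
endFrom≡start+sumδ a (s ∷ ss) =
  ≡.trans (endFrom≡start+sumδ (a ℤ.+ δ s) ss) (ℤ.+-assoc a (δ s) (sumδ ss))

endFrom≡0⇒start≡-sumδ : ∀ a ss → endFrom a ss ≡ + 0 → a ≡ ℤ.- sumδ ss
endFrom≡0⇒start≡-sumδ a ss end≡0 =
  inverseˡ-unique a (sumδ ss) (≡.trans (≡.sym (endFrom≡start+sumδ a ss)) end≡0)

endFrom-sumδ≡0 : ∀ ss → endFrom (ℤ.- sumδ ss) ss ≡ + 0
endFrom-sumδ≡0 ss = ≡.trans (endFrom≡start+sumδ _ ss) (ℤ.+-inverseˡ (sumδ ss))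

-δ≤1 : ∀ s → ℤ.- δ s ℤ.≤ + 1
-δ≤1 dn = ℤ.+≤+ (s≤s z≤n)
-δ≤1 fl = ℤ.+≤+ z≤n
-δ≤1 up = ℤ.-≤+

-sumδ≤length : ∀ ss → ℤ.- sumδ ss ℤ.≤ + length ss
-sumδ≤length []       = ℤ.+≤+ z≤n
-sumδ≤length (s ∷ ss) =
  ≡.subst (ℤ._≤ + length (s ∷ ss)) (≡.sym (ℤ.neg-distrib-+ (δ s) (sumδ ss)))
          (ℤ.+-mono-≤ (-δ≤1 s) (-sumδ≤length ss))

module _ {c ℓ} (R : Ring c ℓ) where
  open Ring R
  open PowerSeries R
  open RingProperties R using (-‿distribˡ-*; -‿+-comm; -0#≈0#)
  open CommutativeSemigroupProperties +-commutativeSemigroup using (interchange)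
  open import Relation.Binary.Reasoning.Setoid setoid

  if-false : ∀ {b} {x} → b ≡ false → (if b then x else 0#) ≈ 0#
  if-false ≡.refl = refl

  if-*ˡ : ∀ b x y → (if b then x * y else 0#) ≈ x * (if b then y else 0#)
  if-*ˡ true  x y = refl
  if-*ˡ false x y = sym (zeroʳ x)

  Σl-++ : ∀ xs ys → Σl (xs ++ ys) ≈ Σl xs + Σl ys
  Σl-++ []       ys = sym (+-identityˡ _)
  Σl-++ (x ∷ xs) ys = trans (+-congˡ (Σl-++ xs ys)) (sym (+-assoc _ _ _))

  module _ {a} {X : Set a} where

    Σl-cong : ∀ {f g : X → Carrier} xs → (∀ x → f x ≈ g x) → Σl (map f xs) ≈ Σl (map g xs)
    Σl-cong []       f≈g = refl
    Σl-cong (x ∷ xs) f≈g = +-cong (f≈g x) (Σl-cong xs f≈g)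

    Σl-zero : ∀ {f : X → Carrier} xs → (∀ x → f x ≈ 0#) → Σl (map f xs) ≈ 0#
    Σl-zero []       f≈0 = refl
    Σl-zero (x ∷ xs) f≈0 = trans (+-cong (f≈0 x) (Σl-zero xs f≈0)) (+-identityʳ 0#)

    Σl-+ : ∀ (f g : X → Carrier) xs →
           Σl (map (λ x → f x + g x) xs) ≈ Σl (map f xs) + Σl (map g xs)
    Σl-+ f g []       = sym (+-identityʳ 0#)
    Σl-+ f g (x ∷ xs) = trans (+-congˡ (Σl-+ f g xs)) (interchange _ _ _ _)

    Σl-*ˡ : ∀ k (f : X → Carrier) xs → Σl (map (λ x → k * f x) xs) ≈ k * Σl (map f xs)
    Σl-*ˡ k f []       = sym (zeroʳ k)
    Σl-*ˡ k f (x ∷ xs) = trans (+-congˡ (Σl-*ˡ k f xs)) (sym (distribˡ k _ _))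

    Σl-linear₂ : ∀ x y (f g : X → Carrier) xs →
                 Σl (map (λ e → x * f e + y * g e) xs) ≈ x * Σl (map f xs) + y * Σl (map g xs)
    Σl-linear₂ x y f g xs = trans (Σl-+ _ _ xs) (+-cong (Σl-*ˡ x f xs) (Σl-*ˡ y g xs))

  Σl-concatMap : ∀ {a b} {X : Set a} {Y : Set b} (f : Y → Carrier) (g : X → List Y) xs →
    Σl (map f (concatMap g xs)) ≈ Σl (map (λ x → Σl (map f (g x))) xs)
  Σl-concatMap f g []       = refl
  Σl-concatMap f g (x ∷ xs) = begin
    Σl (map f (g x ++ concatMap g xs))             ≡⟨ ≡.cong Σl (map-++ f (g x) _) ⟩
    Σl (map f (g x) ++ map f (concatMap g xs))     ≈⟨ Σl-++ (map f (g x)) _ ⟩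
    Σl (map f (g x)) + Σl (map f (concatMap g xs)) ≈⟨ +-congˡ (Σl-concatMap f g xs) ⟩
    Σl (map (λ x → Σl (map f (g x))) (x ∷ xs))     ∎

  ΣSteps : ℕ → (List Step → Carrier) → Carrier
  ΣSteps n f = Σl (map f (stepSeqs n))

  ΣSteps-suc : ∀ n f →
    ΣSteps (suc n) f ≈ ΣSteps n (λ ss → f (dn ∷ ss) + (f (fl ∷ ss) + f (up ∷ ss)))
  ΣSteps-suc n f = trans (Σl-concatMap f _ (stepSeqs n))
                         (Σl-cong (stepSeqs n) (λ ss → +-congˡ (+-congˡ (+-identityʳ _))))

  ΣSteps-cong : ∀ n {f g} → (∀ ss → length ss ≡ n → f ss ≈ g ss) → ΣSteps n f ≈ ΣSteps n g
  ΣSteps-cong zero    f≈g = +-congʳ (f≈g [] ≡.refl)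
  ΣSteps-cong (suc n) {f} {g} f≈g = begin
    ΣSteps (suc n) f ≈⟨ ΣSteps-suc n f ⟩
    _                ≈⟨ ΣSteps-cong n (λ ss l → +-cong (f≈g _ (≡.cong suc l))
                                          (+-cong (f≈g _ (≡.cong suc l)) (f≈g _ (≡.cong suc l)))) ⟩
    _                ≈⟨ ΣSteps-suc n g ⟨
    ΣSteps (suc n) g ∎

  Σ< : ℕ → (ℕ → Carrier) → Carrier
  Σ< zero    f = 0#
  Σ< (suc N) f = f 0 + Σ< N (λ h → f (suc h))

  Σ<-cong : ∀ N {f g} → (∀ h → f h ≈ g h) → Σ< N f ≈ Σ< N g
  Σ<-cong zero    f≈g = refl
  Σ<-cong (suc N) f≈g = +-cong (f≈g 0) (Σ<-cong N (λ h → f≈g (suc h)))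

  Σ<-zero : ∀ N {f} → (∀ h → f h ≈ 0#) → Σ< N f ≈ 0#
  Σ<-zero zero    f≈0 = refl
  Σ<-zero (suc N) f≈0 = trans (+-cong (f≈0 0) (Σ<-zero N (λ h → f≈0 (suc h)))) (+-identityʳ 0#)

  Σ<-single : ∀ N {f} h₀ → h₀ < N → (∀ h → h ≢ h₀ → f h ≈ 0#) → Σ< N f ≈ f h₀
  Σ<-single (suc N) zero     _         f≈0 =
    trans (+-congˡ (Σ<-zero N (λ h → f≈0 (suc h) (λ ())))) (+-identityʳ _)
  Σ<-single (suc N) (suc h₀) (s≤s h₀<N) f≈0 =
    trans (+-cong (f≈0 0 (λ ())) (Σ<-single N h₀ h₀<N (λ h h≢h₀ → f≈0 (suc h) (h≢h₀ ∘ ℕ.suc-injective))))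
          (+-identityˡ _)

  Σl-Σ< : ∀ {a} {X : Set a} N (f : ℕ → X → Carrier) xs →
    Σl (map (λ x → Σ< N (λ h → f h x)) xs) ≈ Σ< N (λ h → Σl (map (f h) xs))
  Σl-Σ< zero    f xs = Σl-zero xs (λ _ → refl)
  Σl-Σ< (suc N) f xs = trans (Σl-+ (f 0) _ xs) (+-congˡ (Σl-Σ< N (λ h → f (suc h)) xs))

  conv : (ℕ → Carrier) → (ℕ → Carrier) → ℕ → Carrier
  conv f g zero    = f 0 * g 0
  conv f g (suc n) = f 0 * g (suc n) + conv (λ i → f (suc i)) g n

  conv-cong : ∀ n {f f′ g g′} → (∀ i → f i ≈ f′ i) → (∀ j → j ≤ n → g j ≈ g′ j) →
              conv f g n ≈ conv f′ g′ n
  conv-cong zero    f≈ g≈ = *-cong (f≈ 0) (g≈ 0 z≤n)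
  conv-cong (suc n) f≈ g≈ = +-cong (*-cong (f≈ 0) (g≈ (suc n) ℕ.≤-refl))
                                   (conv-cong n (λ i → f≈ (suc i)) (λ j j≤n → g≈ j (ℕ.m≤n⇒m≤1+n j≤n)))

  conv-+ˡ : ∀ n f f′ g → conv (λ i → f i + f′ i) g n ≈ conv f g n + conv f′ g n
  conv-+ˡ zero    f f′ g = distribʳ _ _ _
  conv-+ˡ (suc n) f f′ g = trans (+-cong (distribʳ _ _ _) (conv-+ˡ n _ _ g)) (interchange _ _ _ _)

  conv-+ʳ : ∀ n f g g′ → conv f (λ j → g j + g′ j) n ≈ conv f g n + conv f g′ n
  conv-+ʳ zero    f g g′ = distribˡ _ _ _
  conv-+ʳ (suc n) f g g′ = trans (+-cong (distribˡ _ _ _) (conv-+ʳ n _ g g′)) (interchange _ _ _ _)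

  conv-*ˡ : ∀ n x f g → conv (λ i → x * f i) g n ≈ x * conv f g n
  conv-*ˡ zero    x f g = *-assoc _ _ _
  conv-*ˡ (suc n) x f g = trans (+-cong (*-assoc _ _ _) (conv-*ˡ n x _ g)) (sym (distribˡ _ _ _))

  conv-negˡ : ∀ n f g → conv (λ i → - f i) g n ≈ - conv f g n
  conv-negˡ zero    f g = sym (-‿distribˡ-* _ _)
  conv-negˡ (suc n) f g = trans (+-cong (sym (-‿distribˡ-* _ _)) (conv-negˡ n _ g)) (-‿+-comm _ _)

  conv-zeroʳ : ∀ n f {g} → (∀ j → g j ≈ 0#) → conv f g n ≈ 0#
  conv-zeroʳ zero    f g≈0 = trans (*-congˡ (g≈0 0)) (zeroʳ _)
  conv-zeroʳ (suc n) f g≈0 =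
    trans (+-cong (trans (*-congˡ (g≈0 (suc n))) (zeroʳ _)) (conv-zeroʳ n _ g≈0)) (+-identityʳ 0#)

  conv-linear₂ : ∀ n x y f f′ g → conv (λ i → x * f i + y * f′ i) g n ≈ x * conv f g n + y * conv f′ g n
  conv-linear₂ n x y f f′ g = trans (conv-+ˡ n _ _ g) (+-cong (conv-*ˡ n x f g) (conv-*ˡ n y f′ g))

  conv-linear₃ : ∀ n x y z f f′ f″ g →
    conv (λ i → x * f i + (y * f′ i + z * f″ i)) g n ≈ x * conv f g n + (y * conv f′ g n + z * conv f″ g n)
  conv-linear₃ n x y z f f′ f″ g = trans (conv-+ˡ n _ _ g) (+-cong (conv-*ˡ n x f g) (conv-linear₂ n y z f′ f″ g))

  conv-Σ<ʳ : ∀ N n f (g : ℕ → ℕ → Carrier) →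
    conv f (λ j → Σ< N (λ h → g h j)) n ≈ Σ< N (λ h → conv f (g h) n)
  conv-Σ<ʳ zero    n f g = conv-zeroʳ n f (λ _ → refl)
  conv-Σ<ʳ (suc N) n f g = trans (conv-+ʳ n f (g 0) _) (+-congˡ (conv-Σ<ʳ N n f (λ h → g (suc h))))

  conv-suc-last : ∀ n f g → conv f g (suc n) ≈ conv f (λ j → g (suc j)) n + f (suc n) * g 0
  conv-suc-last zero    f g = refl
  conv-suc-last (suc n) f g = trans (+-congˡ (conv-suc-last n (λ i → f (suc i)) g)) (sym (+-assoc _ _ _))

  -- convAux f g i m = Σ_{k ≤ i} f k * g (i - k + m) runs the same sum in the opposite order.
  convAux≈conv : ∀ i m f g → convAux f g i m ≈ conv f (λ j → g (j ℕ.+ m)) i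
  convAux≈conv zero    m f g = refl
  convAux≈conv (suc i) m f g = begin
    f (suc i) * g m + convAux f g i (suc m)           ≈⟨ +-congˡ (convAux≈conv i (suc m) f g) ⟩
    f (suc i) * g m + conv f (λ j → g (j ℕ.+ suc m)) i
      ≈⟨ +-congˡ (conv-cong i (λ _ → refl) (λ j _ → reflexive (≡.cong g (ℕ.+-suc j m)))) ⟩
    f (suc i) * g m + conv f (λ j → g (suc j ℕ.+ m)) i ≈⟨ +-comm _ _ ⟩
    conv f (λ j → g (suc j ℕ.+ m)) i + f (suc i) * g m ≈⟨ conv-suc-last i f (λ j → g (j ℕ.+ m)) ⟨
    conv f (λ j → g (j ℕ.+ m)) (suc i)               ∎

  *PS≈conv : ∀ f g n → (f *PS g) n ≈ conv f g n
  *PS≈conv f g n = trans (convAux≈conv n 0 f g)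
                         (conv-cong n (λ _ → refl) (λ j _ → reflexive (≡.cong g (ℕ.+-identityʳ j))))

  *PS-const : ∀ f a n → (f *PS const a) n ≈ f n * a
  *PS-const f a zero    = refl
  *PS-const f a (suc n) = trans (+-congˡ (shifted n 0)) (+-identityʳ _)
    where
    shifted : ∀ i m → convAux f (const a) i (suc m) ≈ 0#
    shifted zero    m = zeroʳ _
    shifted (suc i) m = trans (+-cong (zeroʳ _) (shifted i (suc m))) (+-identityʳ 0#)

  *PS-zPS-suc : ∀ f n → (f *PS zPS) (suc n) ≈ f n
  *PS-zPS-suc f n = trans (+-cong (zeroʳ _) (atOne n)) (+-identityˡ _)
    where
    beyond : ∀ i m → convAux f zPS i (suc (suc m)) ≈ 0#
    beyond zero    m = zeroʳ _
    beyond (suc i) m = trans (+-cong (zeroʳ _) (beyond i (suc m))) (+-identityʳ 0#)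
    atOne : ∀ i → convAux f zPS i 1 ≈ f i
    atOne zero    = *-identityʳ _
    atOne (suc i) = trans (+-cong (*-identityʳ _) (beyond i 0)) (+-identityʳ _)

  module Heights (A B C D : Carrier) where
    open Weights A B C D

    stdWeight : ℤ → List Step → Carrier
    stdWeight a ss = if standardTo0? a ss then w*From a ss else 0#

    flatWeight : ℕ → Carrier
    flatWeight zero    = D
    flatWeight (suc _) = B

    weightFrom : ℕ → List Step → Carrier
    weightFrom h       (fl ∷ ss) = flatWeight h * weightFrom h ss
    weightFrom h       (up ∷ ss) = C * weightFrom (suc h) ss
    weightFrom (suc h) (dn ∷ ss) = A * weightFrom h ss
    weightFrom zero    (dn ∷ ss) = 0#
    weightFrom zero    []        = 1#
    weightFrom (suc h) []        = 0#

    fromHeight : ℕ → PS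
    fromHeight h n = ΣSteps n (weightFrom h)

    stdWeight-+∷ : ∀ h s ss {a} → + h ℤ.+ δ s ≡ a → stdWeight (+ h) (s ∷ ss) ≈ U* (+ h) s * stdWeight a ss
    stdWeight-+∷ h s ss end≡ =
      trans (reflexive (if-cong (standardTo0?-∷ (+ h) s ss)))
            (trans (if-*ˡ _ _ _) (*-congˡ (reflexive (≡.cong (λ a → stdWeight a ss) end≡))))

    stdWeight-neg : ∀ k ss → stdWeight -[1+ k ] ss ≈ 0#
    stdWeight-neg k []       = if-false (∧-zeroʳ (standard? (walk -[1+ k ] [])))
    stdWeight-neg k (s ∷ ss) = if-false (standardTo0?-∷ -[1+ k ] s ss)

    stdWeight≈weightFrom : ∀ ss h → stdWeight (+ h) ss ≈ weightFrom h ss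
    stdWeight≈weightFrom []        zero    = refl
    stdWeight≈weightFrom []        (suc h) = if-false (∧-zeroʳ (standard? (walk (+ suc h) [])))
    stdWeight≈weightFrom (dn ∷ ss) zero    =
      trans (stdWeight-+∷ 0 dn ss ≡.refl) (trans (*-congˡ (stdWeight-neg 0 ss)) (zeroʳ A))
    stdWeight≈weightFrom (dn ∷ ss) (suc h) =
      trans (stdWeight-+∷ (suc h) dn ss ≡.refl) (*-congˡ (stdWeight≈weightFrom ss h))
    stdWeight≈weightFrom (fl ∷ ss) zero    =
      trans (stdWeight-+∷ 0 fl ss ≡.refl) (*-congˡ (stdWeight≈weightFrom ss 0))
    stdWeight≈weightFrom (fl ∷ ss) (suc h) =
      trans (stdWeight-+∷ (suc h) fl ss (ℤ.+-identityʳ _)) (*-congˡ (stdWeight≈weightFrom ss (suc h)))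
    stdWeight≈weightFrom (up ∷ ss) h       =
      trans (stdWeight-+∷ h up ss (≡.cong +_ (ℕ.+-comm h 1))) (*-congˡ (stdWeight≈weightFrom ss (suc h)))

    stdWeight-≢ : ∀ a ss → a ≢ ℤ.- sumδ ss → stdWeight a ss ≈ 0#
    stdWeight-≢ a ss a≢ = if-false (≡.trans
      (≡.cong (standard? (walk a ss) ∧_) (dec-false (endFrom a ss ℤ.≟ + 0) (a≢ ∘ endFrom≡0⇒start≡-sumδ a ss)))
      (∧-zeroʳ _))

    -- Only the height - sumδ ss, which is at most length ss, lets the walk end at 0.
    Σ<-stdWeight : ∀ N ss → length ss < N → Σ< N (λ h → stdWeight (+ h) ss) ≈ stdWeight (ℤ.- sumδ ss) ss
    Σ<-stdWeight N ss len<N = at (ℤ.- sumδ ss) ≡.refl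
      where
      at : ∀ a → a ≡ ℤ.- sumδ ss → Σ< N (λ h → stdWeight (+ h) ss) ≈ stdWeight a ss
      at (+ h₀)    h₀≡ = Σ<-single N h₀
        (ℕ.≤-<-trans (ℤ.drop‿+≤+ (≡.subst (ℤ._≤ + length ss) (≡.sym h₀≡) (-sumδ≤length ss))) len<N)
        (λ h h≢h₀ → stdWeight-≢ (+ h) ss (λ h≡ → h≢h₀ (ℤ.+-injective (≡.trans h≡ (≡.sym h₀≡)))))
      at -[1+ k ] k≡ =
        trans (Σ<-zero N (λ h → stdWeight-≢ (+ h) ss (λ h≡ → +≢-[1+] (≡.trans h≡ (≡.sym k≡)))))
              (sym (stdWeight-neg k ss))
        where
        +≢-[1+] : ∀ {h} → + h ≢ -[1+ k ]
        +≢-[1+] ()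

    Gw*≈fromHeight0 : ∀ n → Gw* n ≈ fromHeight 0 n
    Gw*≈fromHeight0 n = trans (reflexive (≡.cong Σl (≡.sym (map-∘ (stepSeqs n)))))
                              (Σl-cong (stepSeqs n) (λ ss → stdWeight≈weightFrom ss 0))

    G*₀≈Σ<fromHeight : ∀ n M → n < M → G* 0 n ≈ Σ< M (λ h → fromHeight h n)
    G*₀≈Σ<fromHeight n M n<M = begin
      G* 0 n                                              ≡⟨ ≡.cong Σl (≡.sym (map-∘ (stepSeqs n))) ⟩
      ΣSteps n (λ ss → if standard? (walk (ℤ.- sumδ ss) ss) then (1# + 0#) * w*From (ℤ.- sumδ ss) ss else 0#)
        ≈⟨ Σl-cong (stepSeqs n) endsAt0 ⟩
      ΣSteps n (λ ss → stdWeight (ℤ.- sumδ ss) ss)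
        ≈⟨ ΣSteps-cong n (λ ss len≡n → sym (Σ<-stdWeight M ss (≡.subst (_< M) (≡.sym len≡n) n<M))) ⟩
      ΣSteps n (λ ss → Σ< M (λ h → stdWeight (+ h) ss))
        ≈⟨ Σl-cong (stepSeqs n) (λ ss → Σ<-cong M (stdWeight≈weightFrom ss)) ⟩
      ΣSteps n (λ ss → Σ< M (λ h → weightFrom h ss))      ≈⟨ Σl-Σ< M weightFrom (stepSeqs n) ⟩
      Σ< M (λ h → fromHeight h n)                         ∎
      where
      endsAt0 : ∀ ss → (if standard? (walk (ℤ.- sumδ ss) ss) then (1# + 0#) * w*From (ℤ.- sumδ ss) ss else 0#)
                       ≈ stdWeight (ℤ.- sumδ ss) ss
      endsAt0 ss rewrite dec-true (endFrom (ℤ.- sumδ ss) ss ℤ.≟ + 0) (endFrom-sumδ≡0 ss)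
        with standard? (walk (ℤ.- sumδ ss) ss)
      ... | true  = trans (*-congʳ (+-identityʳ 1#)) (*-identityˡ _)
      ... | false = refl

    fromHeight-0-0 : fromHeight 0 0 ≈ 1#
    fromHeight-0-0 = +-identityʳ 1#

    fromHeight-suc-0 : ∀ h → fromHeight (suc h) 0 ≈ 0#
    fromHeight-suc-0 h = +-identityʳ 0#

    fromHeight-0-suc : ∀ n → fromHeight 0 (suc n) ≈ D * fromHeight 0 n + C * fromHeight 1 n
    fromHeight-0-suc n =
      trans (ΣSteps-suc n (weightFrom 0))
            (trans (Σl-cong (stepSeqs n) (λ _ → +-identityˡ _)) (Σl-linear₂ D C _ _ (stepSeqs n)))

    fromHeight-suc-suc : ∀ h n → fromHeight (suc h) (suc n) ≈
      A * fromHeight h n + (B * fromHeight (suc h) n + C * fromHeight (suc (suc h)) n)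
    fromHeight-suc-suc h n =
      trans (ΣSteps-suc n (weightFrom (suc h)))
            (trans (Σl-+ _ _ (stepSeqs n)) (+-cong (Σl-*ˡ A _ (stepSeqs n)) (Σl-linear₂ B C _ _ (stepSeqs n))))

  wSteps≡w*From : ∀ A B C D a ss → Weights.wSteps A B C D ss ≡ Weights.w*From A B C B a ss
  wSteps≡w*From A B C D a []        = ≡.refl
  wSteps≡w*From A B C D a (dn ∷ ss) = ≡.cong (A *_) (wSteps≡w*From A B C D _ ss)
  wSteps≡w*From A B C D a (fl ∷ ss) = ≡.cong₂ _*_ (≡.sym (if-eta (isZero a))) (wSteps≡w*From A B C D _ ss)
  wSteps≡w*From A B C D a (up ∷ ss) = ≡.cong (C *_) (wSteps≡w*From A B C D _ ss)

  Gw≈fromHeight0 : ∀ A B C D n → Weights.Gw A B C D n ≈ Heights.fromHeight A B C B 0 n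
  Gw≈fromHeight0 A B C D n = trans
    (Σl-cong (walksFrom0 n) λ { (walk a ss) → reflexive (if-cong-then (standardTo0? a ss) (wSteps≡w*From A B C D a ss)) })
    (Heights.Gw*≈fromHeight0 A B C B n)

  module FirstPassage (A B C D : Carrier) where
    open Heights A B C D using (fromHeight; fromHeight-suc-0; fromHeight-suc-suc)
    module Q = Heights A B C B

    -- Walks of length i + 1 from h + 1 that first reach 0 at their last step.
    descent : ℕ → PS
    descent h i = Q.fromHeight h i * A

    descent-0-0 : descent 0 0 ≈ A
    descent-0-0 = trans (*-congʳ Q.fromHeight-0-0) (*-identityˡ A)

    descent-suc-0 : ∀ h → descent (suc h) 0 ≈ 0#
    descent-suc-0 h = trans (*-congʳ (Q.fromHeight-suc-0 h)) (zeroˡ A)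

    descent-0-suc : ∀ i → descent 0 (suc i) ≈ B * descent 0 i + C * descent 1 i
    descent-0-suc i =
      trans (*-congʳ (Q.fromHeight-0-suc i)) (trans (distribʳ _ _ _) (+-cong (*-assoc _ _ _) (*-assoc _ _ _)))

    descent-suc-suc : ∀ h i →
      descent (suc h) (suc i) ≈ A * descent h i + (B * descent (suc h) i + C * descent (suc (suc h)) i)
    descent-suc-suc h i = trans (*-congʳ (Q.fromHeight-suc-suc h i)) (trans (distribʳ _ _ _)
      (+-cong (*-assoc _ _ _) (trans (distribʳ _ _ _) (+-cong (*-assoc _ _ _) (*-assoc _ _ _)))))

    fromHeight-suc-1 : ∀ h → fromHeight (suc h) 1 ≈ A * fromHeight h 0
    fromHeight-suc-1 h = begin
      fromHeight (suc h) 1 ≈⟨ fromHeight-suc-suc h 0 ⟩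
      A * fromHeight h 0 + (B * fromHeight (suc h) 0 + C * fromHeight (suc (suc h)) 0)
        ≈⟨ +-congˡ (+-cong (trans (*-congˡ (fromHeight-suc-0 h)) (zeroʳ B))
                           (trans (*-congˡ (fromHeight-suc-0 (suc h))) (zeroʳ C))) ⟩
      A * fromHeight h 0 + (0# + 0#) ≈⟨ +-congˡ (+-identityʳ 0#) ⟩
      A * fromHeight h 0 + 0#        ≈⟨ +-identityʳ _ ⟩
      A * fromHeight h 0             ∎

    fromHeight-split : ∀ n h k → fromHeight (suc (h ℕ.+ k)) (suc n) ≈ conv (descent h) (fromHeight k) n
    fromHeight-split zero zero    k = trans (fromHeight-suc-1 k) (*-congʳ (sym descent-0-0))
    fromHeight-split zero (suc h) k = begin
      fromHeight (suc (suc h ℕ.+ k)) 1 ≈⟨ fromHeight-suc-1 (suc h ℕ.+ k) ⟩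
      A * fromHeight (suc h ℕ.+ k) 0   ≈⟨ trans (*-congˡ (fromHeight-suc-0 (h ℕ.+ k))) (zeroʳ A) ⟩
      0#                               ≈⟨ trans (*-congʳ (descent-suc-0 h)) (zeroˡ _) ⟨
      descent (suc h) 0 * fromHeight k 0 ∎
    fromHeight-split (suc n) zero k = begin
      fromHeight (suc k) (suc (suc n)) ≈⟨ fromHeight-suc-suc k (suc n) ⟩
      A * fromHeight k (suc n) + (B * fromHeight (suc k) (suc n) + C * fromHeight (suc (suc k)) (suc n))
        ≈⟨ +-cong (*-congʳ (sym descent-0-0))
                  (+-cong (*-congˡ (fromHeight-split n 0 k)) (*-congˡ (fromHeight-split n 1 k))) ⟩
      descent 0 0 * fromHeight k (suc n) + (B * conv (descent 0) _ n + C * conv (descent 1) _ n)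
        ≈⟨ +-congˡ (conv-linear₂ n B C _ _ (fromHeight k)) ⟨
      descent 0 0 * fromHeight k (suc n) + conv (λ i → B * descent 0 i + C * descent 1 i) (fromHeight k) n
        ≈⟨ +-congˡ (conv-cong n (λ i → sym (descent-0-suc i)) (λ _ _ → refl)) ⟩
      conv (descent 0) (fromHeight k) (suc n) ∎
    fromHeight-split (suc n) (suc h) k = begin
      fromHeight (suc (suc h ℕ.+ k)) (suc (suc n)) ≈⟨ fromHeight-suc-suc (suc h ℕ.+ k) (suc n) ⟩
      A * fromHeight (suc (h ℕ.+ k)) (suc n)
        + (B * fromHeight (suc (suc h ℕ.+ k)) (suc n) + C * fromHeight (suc (suc (suc h) ℕ.+ k)) (suc n))
        ≈⟨ +-cong (*-congˡ (fromHeight-split n h k))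
                  (+-cong (*-congˡ (fromHeight-split n (suc h) k)) (*-congˡ (fromHeight-split n (suc (suc h)) k))) ⟩
      A * conv (descent h) _ n + (B * conv (descent (suc h)) _ n + C * conv (descent (suc (suc h))) _ n)
        ≈⟨ conv-linear₃ n A B C _ _ _ (fromHeight k) ⟨
      conv (λ i → A * descent h i + (B * descent (suc h) i + C * descent (suc (suc h)) i)) (fromHeight k) n
        ≈⟨ conv-cong n (λ i → sym (descent-suc-suc h i)) (λ _ _ → refl) ⟩
      conv (λ i → descent (suc h) (suc i)) (fromHeight k) n
        ≈⟨ +-identityˡ _ ⟨
      0# + conv (λ i → descent (suc h) (suc i)) (fromHeight k) n
        ≈⟨ +-congʳ (trans (*-congʳ (descent-suc-0 h)) (zeroˡ _)) ⟨
      conv (descent (suc h)) (fromHeight k) (suc n) ∎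

  module Renewal (A B C D : Carrier) where
    open Weights A B C D
    open Heights A B C D using (fromHeight; Gw*≈fromHeight0; G*₀≈Σ<fromHeight)
    open FirstPassage A B C D using (descent; fromHeight-split)

    G*₀-zero : G* 0 0 ≈ Gw* 0
    G*₀-zero = trans (G*₀≈Σ<fromHeight 0 1 (s≤s z≤n)) (trans (+-identityʳ _) (sym (Gw*≈fromHeight0 0)))

    G*₀-renewal : ∀ m → G* 0 (suc m) ≈ Gw* (suc m) + conv (λ i → Gw i * A) (G* 0) m
    G*₀-renewal m = begin
      G* 0 (suc m) ≈⟨ G*₀≈Σ<fromHeight (suc m) (suc (suc m)) ℕ.≤-refl ⟩
      fromHeight 0 (suc m) + Σ< (suc m) (λ h → fromHeight (suc h) (suc m))
        ≈⟨ +-cong (sym (Gw*≈fromHeight0 (suc m))) (Σ<-cong (suc m) (fromHeight-split m 0)) ⟩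
      Gw* (suc m) + Σ< (suc m) (λ h → conv (descent 0) (fromHeight h) m)
        ≈⟨ +-congˡ (conv-Σ<ʳ (suc m) m (descent 0) fromHeight) ⟨
      Gw* (suc m) + conv (descent 0) (λ j → Σ< (suc m) (λ h → fromHeight h j)) m
        ≈⟨ +-congˡ (conv-cong m (λ i → *-congʳ (sym (Gw≈fromHeight0 A B C D i)))
                                (λ j j≤m → sym (G*₀≈Σ<fromHeight j (suc m) (s≤s j≤m)))) ⟩
      Gw* (suc m) + conv (λ i → Gw i * A) (G* 0) m ∎

  one-minus-z-0 : ∀ f → (onePS -PS (f *PS zPS)) 0 ≈ 1#
  one-minus-z-0 f = trans (+-congˡ (trans (-‿cong (zeroʳ _)) -0#≈0#)) (+-identityʳ 1#)

  one-minus-z-suc : ∀ f i → (onePS -PS (f *PS zPS)) (suc i) ≈ - f i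
  one-minus-z-suc f i = trans (+-identityˡ _) (-‿cong (*PS-zPS-suc f i))

lemma5p6 : ∀ {c ℓ} (R : Ring c ℓ) (A B C D : Ring.Carrier R) →
    let open PowerSeries R
        open Weights A B C D
    in ((onePS -PS ((Gw *PS const A) *PS zPS)) *PS G* 0) ≈PS Gw*
lemma5p6 R A B C D = coefficient
  where
  open Ring R
  open PowerSeries R
  open Weights A B C D
  open Renewal R A B C D
  open import Relation.Binary.Reasoning.Setoid setoid

  X : PS
  X = (Gw *PS const A) *PS zPS

  coefficient : ((onePS -PS X) *PS G* 0) ≈PS Gw*
  coefficient zero = trans (*-cong (one-minus-z-0 R (Gw *PS const A)) G*₀-zero) (*-identityˡ _)
  coefficient (suc m) = begin
    ((onePS -PS X) *PS G* 0) (suc m)  ≈⟨ *PS≈conv R _ _ (suc m) ⟩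
    (onePS -PS X) 0 * G* 0 (suc m) + conv R (λ i → (onePS -PS X) (suc i)) (G* 0) m
      ≈⟨ +-cong (trans (*-congʳ (one-minus-z-0 R (Gw *PS const A))) (*-identityˡ _))
                (conv-cong R m (λ i → trans (one-minus-z-suc R (Gw *PS const A) i) (-‿cong (*PS-const R Gw A i)))
                               (λ _ _ → refl)) ⟩
    G* 0 (suc m) + conv R (λ i → - (Gw i * A)) (G* 0) m
      ≈⟨ +-cong (G*₀-renewal m) (conv-negˡ R m _ (G* 0)) ⟩
    (Gw* (suc m) + c) + - c           ≈⟨ +-assoc _ _ _ ⟩
    Gw* (suc m) + (c + - c)           ≈⟨ +-congˡ (-‿inverseʳ c) ⟩
    Gw* (suc m) + 0#                  ≈⟨ +-identityʳ _ ⟩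
    Gw* (suc m)                       ∎
    where c = conv R (λ i → Gw i * A) (G* 0) m
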